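{- Let $S$ be a group, let $A=\mathrm{Aut}(S)$, let $Z=Z(S)$, and identify $\mathrm{Inn}(S)\cong S/Z$ with a normal subgroup of $A$ via the conjugation action; for $T\leq S$ let $\overline T=TZ/Z\leq \mathrm{Inn}(S)$. Suppose $S$ has a characteristic subgroup $T$ such that $\overline T$ is a proper subgroup of $\overline S=\mathrm{Inn}(S)$ and $A/\overline T$ is abelian (note $\overline T\trianglelefteq A$ as $T$ is characteristic). Then $S$ is not a chirality group.
   Context: Let $\Delta=\langle r_0,r_1,r_2\mid r_0^2=r_1^2=r_2^2=1\rangle$ and let $\Delta^+$ be its index-$2$ subgroup of even-length words, generated by $\rho=r_1r_2$ and $\lambda=r_2r_0$. An (oriented) hypermap is a triple $(D,R,L)$ with $D$ a finite set and $R,L$ permutations of $D$ generating a group transitive on $D$ (the monodromy group). It is orientably regular if its automorphism group (permutations of $D$ commuting with $R$ and $L$) acts regularly on $D$; orientably regular hypermaps correspond (up to isomorphism) bijectively to normal subgroups $H$ of finite index in $\Delta^+$ (hypermap subgroups), the hypermap being $(\Delta^+/H,\rho,\lambda)$ acting by left multiplication. For $H\trianglelefteq\Delta^+$ put $H^r=r_2Hr_2$. The chirality group of the hypermap is $HH^r/H$ (isomorphic to $H/(H\cap H^r)$). A group $G$ is called a chirality group if $G$ is isomorphic to the chirality group of some orientably regular hypermap. -}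

module Defs where

open import Level using (Level; _⊔_; 0ℓ) renaming (suc to lsuc)
open import Algebra.Bundles using (Group)
open import Data.Nat using (ℕ; _%_)
open import Data.Fin using (Fin; zero; suc)
open import Data.List using (List; []; _∷_; _++_; reverse; length)
open import Data.Product using (Σ; ∃; ∃-syntax; _×_)
open import Relation.Nullary using (¬_)
open import Relation.Binary.PropositionalEquality using (_≡_)
open import Relation.Binary.Construct.Closure.Equivalence using (EqClosure)

module _ {c ℓ : Level} (S : Group c ℓ) where
  open Group S

  record Aut : Set (c ⊔ ℓ) where
    field
      to       : Carrier → Carrier
      from     : Carrier → Carrier
      to-cong  : ∀ {x y} → x ≈ y → to x ≈ to y
      from-cong : ∀ {x y} → x ≈ y → from x ≈ from y
      to-hom   : ∀ x y → to (x ∙ y) ≈ to x ∙ to y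
      to-from  : ∀ x → to (from x) ≈ x
      from-to  : ∀ x → from (to x) ≈ x

  record IsSubgroup {t : Level} (T : Carrier → Set t) : Set (c ⊔ ℓ ⊔ t) where
    field
      resp  : ∀ {x y} → x ≈ y → T x → T y
      unit  : T ε
      mul   : ∀ {x y} → T x → T y → T (x ∙ y)
      inv   : ∀ {x} → T x → T (x ⁻¹)

  record IsCharacteristic {t : Level} (T : Carrier → Set t) : Set (c ⊔ ℓ ⊔ t) where
    field
      subgroup  : IsSubgroup T
      invariant : (α : Aut) → ∀ {x} → T x → T (Aut.to α x)

  conj : Carrier → Carrier → Carrier
  conj s x = s ∙ x ∙ s ⁻¹

  InTbar : {t : Level} → (Carrier → Set t) → (Carrier → Carrier) → Set (c ⊔ ℓ ⊔ t)
  InTbar T φ = ∃[ τ ] (T τ × (∀ x → φ x ≈ conj τ x))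

  TbarProper : {t : Level} → (Carrier → Set t) → Set (c ⊔ ℓ ⊔ t)
  TbarProper T = ¬ (∀ s → InTbar T (conj s))

  -- A / T̄ is abelian: for all α β ∈ Aut(S), αβ ≡ βα modulo T̄,
  -- i.e. the commutator αβα⁻¹β⁻¹ lies in T̄
  AutModTbarAbelian : {t : Level} → (Carrier → Set t) → Set (c ⊔ ℓ ⊔ t)
  AutModTbarAbelian T = (α β : Aut) →
    InTbar T (λ x → Aut.to α (Aut.to β (Aut.from α (Aut.from β x))))

-- The extended triangle group Δ = ⟨ r₀ , r₁ , r₂ | r₀² = r₁² = r₂² = 1 ⟩
-- Elements are words in the generators (Fin 3), modulo the congruence
-- generated by deleting a factor rᵢ rᵢ.

Word : Set
Word = List (Fin 3)

r₂ : Fin 3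
r₂ = suc (suc zero)

data _⟶_ : Word → Word → Set where
  cancel : ∀ xs i ys → (xs ++ i ∷ i ∷ ys) ⟶ (xs ++ ys)

_≈Δ_ : Word → Word → Set
_≈Δ_ = EqClosure _⟶_

-- multiplication is concatenation, inverse is reversal (each rᵢ is an involution)
-- Δ⁺ : the words of even length
Even : Word → Set
Even w = length w % 2 ≡ 0

record HypermapSubgroup (H : Word → Set) : Set where
  field
    inΔ⁺   : ∀ {w} → H w → Even w
    resp   : ∀ {u v} → u ≈Δ v → H u → H v
    unit   : H []
    mul    : ∀ {u v} → H u → H v → H (u ++ v)
    inv    : ∀ {u} → H u → H (reverse u)
    normal : ∀ {g h} → Even g → H h → H (g ++ h ++ reverse g)
    index  : ℕ
    reps   : Fin index → Word
    reps-even : ∀ i → Even (reps i)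
    cover  : ∀ w → Even w → ∃[ i ] H (reverse (reps i) ++ w)

Mirror : (Word → Set) → Word → Set
Mirror H w = H (r₂ ∷ w ++ r₂ ∷ [])

HHr : (Word → Set) → Word → Set
HHr H w = ∃[ h ] ∃[ k ] (H h × Mirror H k × w ≈Δ (h ++ k))

_∼[_]_ : Word → (Word → Set) → Word → Set
u ∼[ H ] v = H (reverse u ++ v)

-- a group isomorphism S ≅ H Hʳ / H (written out: a map into H Hʳ which is
-- well defined, injective, multiplicative and surjective modulo H)
record ChiralityIso {c ℓ : Level} (H : Word → Set) (S : Group c ℓ) : Set (c ⊔ ℓ) where
  open Group S
  field
    f      : Carrier → Word
    f-in   : ∀ x → HHr H (f x)
    f-cong : ∀ {x y} → x ≈ y → f x ∼[ H ] f y
    f-inj  : ∀ {x y} → f x ∼[ H ] f y → x ≈ y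
    f-hom  : ∀ x y → f (x ∙ y) ∼[ H ] (f x ++ f y)
    f-surj : ∀ w → HHr H w → ∃[ x ] (f x ∼[ H ] w)

-- S is a chirality group: S ≅ H Hʳ / H for some hypermap subgroup H,
-- i.e. S is the chirality group of some orientably regular hypermap
IsChiralityGroup : {c ℓ : Level} → Group c ℓ → Set (lsuc 0ℓ ⊔ c ⊔ ℓ)
IsChiralityGroup S = Σ (Word → Set) λ H → HypermapSubgroup H × ChiralityIso H S

{-# OPTIONS --safe #-}
-- Δ⁺ acts on S ≅ HHʳ/H by conjugation, g ↦ θ g ∈ Aut(S); H acts trivially, and f(s) ∈ HHʳ acts
-- as conjugation by s. As A/T̄ is abelian, θ maps commutators of Δ⁺ into T̄, and modulo
-- commutators r₂ acts on Δ⁺ as inversion, so θ(g gʳ) ∈ T̄ for every g ∈ Δ⁺. Writing f(s) = h k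
-- with h, kʳ ∈ H then gives conj s = θ k = θ(k kʳ) ∈ T̄, i.e. S̄ = T̄.
module Submission where

open import Defs
open import Level using (Level)
open import Algebra.Bundles using (Group)
open import Relation.Nullary using (¬_)
open import Data.Nat using (suc; _%_)
open import Data.Nat.Properties using (+-comm)
open import Data.Fin using (Fin)
open import Data.List using ([]; _∷_; _++_; reverse; length)
open import Data.List.Properties
  using (++-assoc; ++-identityʳ; reverse-++; reverse-involutive; length-reverse; length-++; ++-monoid)
open import Data.Product using (Σ; _,_; proj₁; proj₂)
open import Function using (_∘_)
open import Relation.Binary.Bundles using (Setoid)
open import Relation.Binary.PropositionalEquality as ≡ using (_≡_; refl)
import Relation.Binary.Construct.Closure.Equivalence as EqClosure
open import Algebra.Solver.Monoid (++-monoid (Fin 3)) using (solve; _⊜_; _⊕_)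
import Algebra.Properties.Group as GroupProperties
import Relation.Binary.Reasoning.Setoid as SetoidReasoning

Δ-setoid : Setoid _ _
Δ-setoid = EqClosure.setoid _⟶_

module Δ = Setoid Δ-setoid
module ≈Δ-Reasoning = SetoidReasoning Δ-setoid

cancel-pair : ∀ xs i ys → (xs ++ i ∷ i ∷ ys) ≈Δ (xs ++ ys)
cancel-pair xs i ys = EqClosure.return (cancel xs i ys)

map-≈Δ : (F : Word → Word) → (∀ xs i ys → F (xs ++ i ∷ i ∷ ys) ≈Δ F (xs ++ ys)) →
         ∀ {u v} → u ≈Δ v → F u ≈Δ F v
map-≈Δ F F-cancel = EqClosure.gfold Δ.isEquivalence F λ { (cancel xs i ys) → F-cancel xs i ys }

++-congˡ : ∀ a {u v} → u ≈Δ v → (a ++ u) ≈Δ (a ++ v)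
++-congˡ a = map-≈Δ (a ++_) λ xs i ys → begin
  a ++ xs ++ i ∷ i ∷ ys    ≡⟨ ++-assoc a xs (i ∷ i ∷ ys) ⟨
  (a ++ xs) ++ i ∷ i ∷ ys  ≈⟨ cancel-pair (a ++ xs) i ys ⟩
  (a ++ xs) ++ ys          ≡⟨ ++-assoc a xs ys ⟩
  a ++ xs ++ ys            ∎
  where open ≈Δ-Reasoning

++-congʳ : ∀ b {u v} → u ≈Δ v → (u ++ b) ≈Δ (v ++ b)
++-congʳ b = map-≈Δ (_++ b) λ xs i ys → begin
  (xs ++ i ∷ i ∷ ys) ++ b  ≡⟨ ++-assoc xs (i ∷ i ∷ ys) b ⟩
  xs ++ i ∷ i ∷ ys ++ b    ≈⟨ cancel-pair xs i (ys ++ b) ⟩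
  xs ++ ys ++ b            ≡⟨ ++-assoc xs ys b ⟨
  (xs ++ ys) ++ b          ∎
  where open ≈Δ-Reasoning

reverse-cong : ∀ {u v} → u ≈Δ v → reverse u ≈Δ reverse v
reverse-cong = map-≈Δ reverse λ xs i ys → begin
  reverse (xs ++ i ∷ i ∷ ys)                ≡⟨ reverse-++ xs (i ∷ i ∷ ys) ⟩
  reverse (i ∷ i ∷ ys) ++ reverse xs        ≡⟨ ≡.cong (_++ reverse xs) (reverse-++ (i ∷ i ∷ []) ys) ⟩
  (reverse ys ++ i ∷ i ∷ []) ++ reverse xs  ≡⟨ ++-assoc (reverse ys) (i ∷ i ∷ []) (reverse xs) ⟩
  reverse ys ++ i ∷ i ∷ reverse xs          ≈⟨ cancel-pair (reverse ys) i (reverse xs) ⟩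
  reverse ys ++ reverse xs                  ≡⟨ reverse-++ xs ys ⟨
  reverse (xs ++ ys)                        ∎
  where open ≈Δ-Reasoning

reverse-inverseˡ : ∀ u → (reverse u ++ u) ≈Δ []
reverse-inverseˡ []      = Δ.refl
reverse-inverseˡ (i ∷ u) = begin
  reverse (i ∷ u) ++ i ∷ u        ≡⟨ ≡.cong (_++ i ∷ u) (reverse-++ (i ∷ []) u) ⟩
  (reverse u ++ i ∷ []) ++ i ∷ u  ≡⟨ ++-assoc (reverse u) (i ∷ []) (i ∷ u) ⟩
  reverse u ++ i ∷ i ∷ u          ≈⟨ cancel-pair (reverse u) i u ⟩
  reverse u ++ u                  ≈⟨ reverse-inverseˡ u ⟩
  []                              ∎
  where open ≈Δ-Reasoning

reverse-inverseʳ : ∀ u → (u ++ reverse u) ≈Δ []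
reverse-inverseʳ u =
  ≡.subst (λ v → (v ++ reverse u) ≈Δ []) (reverse-involutive u) (reverse-inverseˡ (reverse u))

cancel-reverseˡ : ∀ a m b → (a ++ reverse m ++ m ++ b) ≈Δ (a ++ b)
cancel-reverseˡ a m b = ++-congˡ a (begin
  reverse m ++ m ++ b    ≡⟨ ++-assoc (reverse m) m b ⟨
  (reverse m ++ m) ++ b  ≈⟨ ++-congʳ b (reverse-inverseˡ m) ⟩
  b                      ∎)
  where open ≈Δ-Reasoning

cancel-reverseʳ : ∀ a m b → (a ++ m ++ reverse m ++ b) ≈Δ (a ++ b)
cancel-reverseʳ a m b =
  ≡.subst (λ v → (a ++ v ++ reverse m ++ b) ≈Δ (a ++ b)) (reverse-involutive m)
          (cancel-reverseˡ a (reverse m) b)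

conjugate : Word → Word → Word
conjugate g w = g ++ w ++ reverse g

mirror : Word → Word
mirror = conjugate (r₂ ∷ [])

commutatorʷ : Word → Word → Word
commutatorʷ u v = u ++ v ++ reverse u ++ reverse v

conjugate-congʳ : ∀ g {u v} → u ≈Δ v → conjugate g u ≈Δ conjugate g v
conjugate-congʳ g e = ++-congˡ g (++-congʳ (reverse g) e)

conjugate-congˡ : ∀ {g h} w → g ≈Δ h → conjugate g w ≈Δ conjugate h w
conjugate-congˡ {g} {h} w e =
  Δ.trans (++-congʳ (w ++ reverse g) e) (++-congˡ h (++-congˡ w (reverse-cong e)))

conjugate-∘ : ∀ u v w → conjugate u (conjugate v w) ≡ conjugate (u ++ v) w
conjugate-∘ u v w = begin
  u ++ (v ++ w ++ reverse v) ++ reverse u  ≡⟨ solve 5 (λ u v w v' u' → u ⊕ (v ⊕ w ⊕ v') ⊕ u' ⊜ (u ⊕ v) ⊕ w ⊕ (v' ⊕ u')) refl u v w (reverse v) (reverse u) ⟩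
  (u ++ v) ++ w ++ reverse v ++ reverse u  ≡⟨ ≡.cong (λ r → (u ++ v) ++ w ++ r) (reverse-++ u v) ⟨
  (u ++ v) ++ w ++ reverse (u ++ v)        ∎
  where open ≡.≡-Reasoning

reverse-conjugate : ∀ g w → reverse (conjugate g w) ≡ conjugate g (reverse w)
reverse-conjugate g w = begin
  reverse (g ++ w ++ reverse g)                   ≡⟨ reverse-++ g (w ++ reverse g) ⟩
  reverse (w ++ reverse g) ++ reverse g           ≡⟨ ≡.cong (_++ reverse g) (reverse-++ w (reverse g)) ⟩
  (reverse (reverse g) ++ reverse w) ++ reverse g ≡⟨ ≡.cong (λ r → (r ++ reverse w) ++ reverse g) (reverse-involutive g) ⟩
  (g ++ reverse w) ++ reverse g                   ≡⟨ ++-assoc g (reverse w) (reverse g) ⟩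
  g ++ reverse w ++ reverse g                     ∎
  where open ≡.≡-Reasoning

conjugate-++ : ∀ g u v → conjugate g (u ++ v) ≈Δ (conjugate g u ++ conjugate g v)
conjugate-++ g u v = Δ.sym (begin
  (g ++ u ++ reverse g) ++ g ++ v ++ reverse g  ≡⟨ solve 4 (λ g u g' v → (g ⊕ u ⊕ g') ⊕ g ⊕ v ⊕ g' ⊜ (g ⊕ u) ⊕ g' ⊕ g ⊕ (v ⊕ g')) refl g u (reverse g) v ⟩
  (g ++ u) ++ reverse g ++ g ++ v ++ reverse g  ≈⟨ cancel-reverseˡ (g ++ u) g (v ++ reverse g) ⟩
  (g ++ u) ++ v ++ reverse g                    ≡⟨ solve 4 (λ g u v g' → (g ⊕ u) ⊕ v ⊕ g' ⊜ g ⊕ (u ⊕ v) ⊕ g') refl g u v (reverse g) ⟩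
  g ++ (u ++ v) ++ reverse g                    ∎)
  where open ≈Δ-Reasoning

conjugate-conjugate : ∀ c g w →
  conjugate c (conjugate g w) ≈Δ conjugate (conjugate c g) (conjugate c w)
conjugate-conjugate c g w = begin
  conjugate c (g ++ w ++ reverse g)                          ≈⟨ conjugate-++ c g (w ++ reverse g) ⟩
  conjugate c g ++ conjugate c (w ++ reverse g)              ≈⟨ ++-congˡ (conjugate c g) (conjugate-++ c w (reverse g)) ⟩
  conjugate c g ++ conjugate c w ++ conjugate c (reverse g)  ≡⟨ ≡.cong (λ r → conjugate c g ++ conjugate c w ++ r) (reverse-conjugate c g) ⟨
  conjugate (conjugate c g) (conjugate c w)                  ∎
  where open ≈Δ-Reasoning

even-++ : ∀ u {v} → Even u → Even v → Even (u ++ v)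
even-++ []           _  ev = ev
even-++ (_ ∷ _ ∷ u) eu ev = even-++ u eu ev

even-reverse : ∀ u → Even u → Even (reverse u)
even-reverse u = ≡.subst (λ n → n % 2 ≡ 0) (≡.sym (length-reverse u))

length-mirror : ∀ w → length (mirror w) ≡ suc (suc (length w))
length-mirror w = ≡.cong suc (≡.trans (length-++ w) (+-comm (length w) 1))

even-mirror : ∀ w → Even w → Even (mirror w)
even-mirror w = ≡.subst (λ n → n % 2 ≡ 0) (≡.sym (length-mirror w))

even-mirror⁻¹ : ∀ w → Even (mirror w) → Even w
even-mirror⁻¹ w = ≡.subst (λ n → n % 2 ≡ 0) (length-mirror w)

length-cancel : ∀ xs (i : Fin 3) ys → length (xs ++ i ∷ i ∷ ys) ≡ suc (suc (length (xs ++ ys)))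
length-cancel []       i ys = refl
length-cancel (_ ∷ xs) i ys = ≡.cong suc (length-cancel xs i ys)

parity-cong : ∀ {u v} → u ≈Δ v → length u % 2 ≡ length v % 2
parity-cong = EqClosure.gfold ≡.isEquivalence (λ w → length w % 2)
  λ { (cancel xs i ys) → ≡.cong (_% 2) (length-cancel xs i ys) }

even-resp : ∀ {u v} → u ≈Δ v → Even u → Even v
even-resp e = ≡.trans (≡.sym (parity-cong e))

Δ⁺ : Set
Δ⁺ = Σ Word Even

infixl 7 _·_
_·_ : Δ⁺ → Δ⁺ → Δ⁺
(u , eu) · (v , ev) = u ++ v , even-++ u eu ev

_⁻¹⁺ : Δ⁺ → Δ⁺
(u , eu) ⁻¹⁺ = reverse u , even-reverse u eu

_ʳ : Δ⁺ → Δ⁺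
(u , eu) ʳ = mirror u , even-mirror u eu

commutator : Δ⁺ → Δ⁺ → Δ⁺
commutator g h = g · (h · (g ⁻¹⁺ · h ⁻¹⁺))

-- The reflection r₂ inverts ρ = r₁r₂ and λ = r₂r₀, so it acts on Δ⁺ as inversion modulo
-- commutators; concretely, (abg)(abg)ʳ = [a r₂ , r₂ b] [r₂ b a r₂ , g] g gʳ in Δ.
twisted-square-∷ : ∀ a b g → ((a ∷ b ∷ g) ++ mirror (a ∷ b ∷ g)) ≈Δ
  (commutatorʷ (a ∷ r₂ ∷ []) (r₂ ∷ b ∷ []) ++ commutatorʷ (r₂ ∷ b ∷ a ∷ r₂ ∷ []) g ++ g ++ mirror g)
twisted-square-∷ a b g = Δ.sym (begin
  commutatorʷ u v ++ (q ++ g ++ reverse q ++ reverse g) ++ g ++ mirror g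
    ≡⟨ solve 6 (λ C q g q' g' M → C ⊕ (q ⊕ g ⊕ q' ⊕ g') ⊕ g ⊕ M ⊜ (C ⊕ q) ⊕ g ⊕ q' ⊕ g' ⊕ g ⊕ M)
             refl (commutatorʷ u v) q g (reverse q) (reverse g) (mirror g) ⟩
  (commutatorʷ u v ++ q) ++ g ++ reverse q ++ reverse g ++ g ++ mirror g
    ≈⟨ ++-congʳ (g ++ reverse q ++ reverse g ++ g ++ mirror g) [u,v]q≈ab ⟩
  a ∷ b ∷ g ++ reverse q ++ reverse g ++ g ++ mirror g
    ≈⟨ ++-congˡ (a ∷ b ∷ g) (cancel-reverseˡ (reverse q) g (mirror g)) ⟩
  a ∷ b ∷ g ++ r₂ ∷ a ∷ b ∷ r₂ ∷ r₂ ∷ g ++ r₂ ∷ []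
    ≈⟨ ++-congˡ (a ∷ b ∷ g) (cancel-pair (r₂ ∷ a ∷ b ∷ []) r₂ (g ++ r₂ ∷ [])) ⟩
  a ∷ b ∷ g ++ r₂ ∷ a ∷ b ∷ g ++ r₂ ∷ []
    ∎)
  where
  open ≈Δ-Reasoning
  u v q : Word
  u = a ∷ r₂ ∷ []
  v = r₂ ∷ b ∷ []
  q = r₂ ∷ b ∷ a ∷ r₂ ∷ []
  [u,v]q≈ab : (commutatorʷ u v ++ q) ≈Δ (a ∷ b ∷ [])
  [u,v]q≈ab = begin
    a ∷ r₂ ∷ r₂ ∷ b ∷ r₂ ∷ a ∷ b ∷ r₂ ∷ r₂ ∷ b ∷ a ∷ r₂ ∷ []  ≈⟨ cancel-pair (a ∷ []) r₂ _ ⟩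
    a ∷ b ∷ r₂ ∷ a ∷ b ∷ r₂ ∷ r₂ ∷ b ∷ a ∷ r₂ ∷ []            ≈⟨ cancel-pair (a ∷ b ∷ r₂ ∷ a ∷ b ∷ []) r₂ _ ⟩
    a ∷ b ∷ r₂ ∷ a ∷ b ∷ b ∷ a ∷ r₂ ∷ []                      ≈⟨ cancel-pair (a ∷ b ∷ r₂ ∷ a ∷ []) b _ ⟩
    a ∷ b ∷ r₂ ∷ a ∷ a ∷ r₂ ∷ []                              ≈⟨ cancel-pair (a ∷ b ∷ r₂ ∷ []) a _ ⟩
    a ∷ b ∷ r₂ ∷ r₂ ∷ []                                      ≈⟨ cancel-pair (a ∷ b ∷ []) r₂ [] ⟩
    a ∷ b ∷ []                                                ∎

module Hypermap {H : Word → Set} (hs : HypermapSubgroup H) where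
  open HypermapSubgroup hs

  -- u ≋ v means uH = vH; the record keeps u and v inferable, which H (reverse u ++ v) does not.
  infix 4 _≋_
  record _≋_ (u v : Word) : Set where
    constructor coset
    field same-coset : u ∼[ H ] v

  ≈Δ⇒≋ : ∀ {u v} → u ≈Δ v → u ≋ v
  ≈Δ⇒≋ {u} e = coset (resp (Δ.trans (Δ.sym (reverse-inverseˡ u)) (++-congˡ (reverse u) e)) unit)

  ≋-sym : ∀ {u v} → u ≋ v → v ≋ u
  ≋-sym {u} {v} (coset p) = coset (≡.subst H eq (inv p))
    where
    eq : reverse (reverse u ++ v) ≡ reverse v ++ u
    eq = ≡.trans (reverse-++ (reverse u) v) (≡.cong (reverse v ++_) (reverse-involutive u))

  ≋-trans : ∀ {u v w} → u ≋ v → v ≋ w → u ≋ w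
  ≋-trans {u} {v} {w} (coset p) (coset q) = coset (resp e (mul p q))
    where
    e : ((reverse u ++ v) ++ reverse v ++ w) ≈Δ (reverse u ++ w)
    e = Δ.trans (Δ.reflexive (++-assoc (reverse u) v _)) (cancel-reverseʳ (reverse u) v w)

  ≋-setoid : Setoid _ _
  ≋-setoid = record
    { _≈_ = _≋_
    ; isEquivalence = record { refl = ≈Δ⇒≋ Δ.refl ; sym = ≋-sym ; trans = ≋-trans }
    }

  module ≋-Reasoning = SetoidReasoning ≋-setoid

  ≋-congˡ : ∀ c {u v} → u ≋ v → c ++ u ≋ c ++ v
  ≋-congˡ c {u} {v} (coset p) = coset (resp (Δ.sym e) p)
    where
    open ≈Δ-Reasoning
    e : (reverse (c ++ u) ++ c ++ v) ≈Δ (reverse u ++ v)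
    e = begin
      reverse (c ++ u) ++ c ++ v            ≡⟨ ≡.cong (_++ c ++ v) (reverse-++ c u) ⟩
      (reverse u ++ reverse c) ++ c ++ v    ≡⟨ ++-assoc (reverse u) (reverse c) (c ++ v) ⟩
      reverse u ++ reverse c ++ c ++ v      ≈⟨ cancel-reverseˡ (reverse u) c v ⟩
      reverse u ++ v                        ∎

  ≋-congʳ : ∀ c {u v} → Even c → u ≋ v → u ++ c ≋ v ++ c
  ≋-congʳ c {u} {v} ec (coset p) = coset (≡.subst H eq (normal {reverse c} (even-reverse c ec) p))
    where
    open ≡.≡-Reasoning
    eq : conjugate (reverse c) (reverse u ++ v) ≡ reverse (u ++ c) ++ v ++ c
    eq = begin
      reverse c ++ (reverse u ++ v) ++ reverse (reverse c)  ≡⟨ ≡.cong (λ r → reverse c ++ (reverse u ++ v) ++ r) (reverse-involutive c) ⟩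
      reverse c ++ (reverse u ++ v) ++ c                    ≡⟨ solve 4 (λ c' u' v c → c' ⊕ (u' ⊕ v) ⊕ c ⊜ (c' ⊕ u') ⊕ v ⊕ c) refl (reverse c) (reverse u) v c ⟩
      (reverse c ++ reverse u) ++ v ++ c                    ≡⟨ ≡.cong (_++ v ++ c) (reverse-++ u c) ⟨
      reverse (u ++ c) ++ v ++ c                            ∎

  ≋-conjugate : ∀ g {u v} → Even g → u ≋ v → conjugate g u ≋ conjugate g v
  ≋-conjugate g eg = ≋-congˡ g ∘ ≋-congʳ (reverse g) (even-reverse g eg)

  conjugate-absorb : ∀ {h n} → H h → Even n → conjugate h n ≋ n
  conjugate-absorb {h} {n} h∈H en =
    coset (≡.subst H (≡.sym eq) (mul h∈H (normal {reverse n} (even-reverse n en) (inv h∈H))))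
    where
    open ≡.≡-Reasoning
    eq : reverse (conjugate h n) ++ n ≡ h ++ conjugate (reverse n) (reverse h)
    eq = begin
      reverse (conjugate h n) ++ n                    ≡⟨ ≡.cong (_++ n) (reverse-conjugate h n) ⟩
      (h ++ reverse n ++ reverse h) ++ n              ≡⟨ solve 4 (λ h n' h' n → (h ⊕ n' ⊕ h') ⊕ n ⊜ h ⊕ n' ⊕ h' ⊕ n) refl h (reverse n) (reverse h) n ⟩
      h ++ reverse n ++ reverse h ++ n                ≡⟨ ≡.cong (λ r → h ++ reverse n ++ reverse h ++ r) (reverse-involutive n) ⟨
      h ++ conjugate (reverse n) (reverse h)          ∎

  HHr-even : ∀ {w} → HHr H w → Even w
  HHr-even (h , k , h∈H , k∈Hʳ , w≈hk) =
    even-resp (Δ.sym w≈hk) (even-++ h (inΔ⁺ h∈H) (even-mirror⁻¹ k (inΔ⁺ k∈Hʳ)))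

  Mirror-conjugate : ∀ g {k} → Even g → Mirror H k → Mirror H (conjugate g k)
  Mirror-conjugate g {k} eg k∈Hʳ =
    resp (Δ.sym (conjugate-conjugate (r₂ ∷ []) g k)) (normal {mirror g} (even-mirror g eg) k∈Hʳ)

  HHr-conjugate : ∀ g {w} → Even g → HHr H w → HHr H (conjugate g w)
  HHr-conjugate g eg (h , k , h∈H , k∈Hʳ , w≈hk) =
    conjugate g h , conjugate g k , normal {g} eg h∈H , Mirror-conjugate g eg k∈Hʳ ,
    Δ.trans (conjugate-congʳ g w≈hk) (conjugate-++ g h k)

module ConjugationAction {H : Word → Set} (hs : HypermapSubgroup H)
                         {c ℓ : Level} {S : Group c ℓ} (iso : ChiralityIso H S) where
  open HypermapSubgroup hs using (resp; unit)
  open Hypermap hs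
  open Group S
  open ChiralityIso iso using (f; f-in)
  module Iso = ChiralityIso iso

  f-cong : ∀ {x y} → x ≈ y → f x ≋ f y
  f-cong = coset ∘ Iso.f-cong

  f-injective : ∀ {x y} → f x ≋ f y → x ≈ y
  f-injective (coset p) = Iso.f-inj p

  f-homo : ∀ x y → f (x ∙ y) ≋ f x ++ f y
  f-homo x y = coset (Iso.f-hom x y)

  f-even : ∀ x → Even (f x)
  f-even x = HHr-even (f-in x)

  f-identity : f ε ≋ []
  f-identity = ≋-sym (begin
    []                           ≈⟨ ≈Δ⇒≋ (reverse-inverseˡ (f ε)) ⟨
    reverse (f ε) ++ f ε         ≈⟨ ≋-congˡ (reverse (f ε)) (≋-trans (f-cong (sym (identityˡ ε))) (f-homo ε ε)) ⟩
    reverse (f ε) ++ f ε ++ f ε  ≈⟨ ≈Δ⇒≋ (cancel-reverseˡ [] (f ε) (f ε)) ⟩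
    f ε                          ∎)
    where open ≋-Reasoning

  f-inverse : ∀ s → f (s ⁻¹) ≋ reverse (f s)
  f-inverse s = begin
    f (s ⁻¹)                         ≈⟨ ≈Δ⇒≋ (cancel-reverseˡ [] (f s) (f (s ⁻¹))) ⟨
    reverse (f s) ++ f s ++ f (s ⁻¹)  ≈⟨ ≋-congˡ (reverse (f s)) fs·fs⁻¹≋[] ⟩
    reverse (f s) ++ []              ≡⟨ ++-identityʳ (reverse (f s)) ⟩
    reverse (f s)                    ∎
    where
    open ≋-Reasoning
    fs·fs⁻¹≋[] : f s ++ f (s ⁻¹) ≋ []
    fs·fs⁻¹≋[] = ≋-trans (≋-sym (f-homo s (s ⁻¹))) (≋-trans (f-cong (inverseʳ s)) f-identity)

  -- Kept abstract so that the witness chosen by f-surj is never unfolded during unification.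
  abstract
    θ : Δ⁺ → Carrier → Carrier
    θ (w , ew) y = proj₁ (Iso.f-surj (conjugate w (f y)) (HHr-conjugate w ew (f-in y)))

    θ-spec : ∀ g y → f (θ g y) ≋ conjugate (proj₁ g) (f y)
    θ-spec (w , ew) y = coset (proj₂ (Iso.f-surj (conjugate w (f y)) (HHr-conjugate w ew (f-in y))))

  θ-cong : ∀ g {x y} → x ≈ y → θ g x ≈ θ g y
  θ-cong g@(w , ew) {x} {y} x≈y = f-injective (begin
    f (θ g x)            ≈⟨ θ-spec g x ⟩
    conjugate w (f x)    ≈⟨ ≋-conjugate w ew (f-cong x≈y) ⟩
    conjugate w (f y)    ≈⟨ θ-spec g y ⟨
    f (θ g y)            ∎)
    where open ≋-Reasoning

  θ-resp : ∀ g h → proj₁ g ≈Δ proj₁ h → ∀ x → θ g x ≈ θ h x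
  θ-resp g@(u , _) h@(v , _) u≈v x = f-injective (begin
    f (θ g x)            ≈⟨ θ-spec g x ⟩
    conjugate u (f x)    ≈⟨ ≈Δ⇒≋ (conjugate-congˡ (f x) u≈v) ⟩
    conjugate v (f x)    ≈⟨ θ-spec h x ⟨
    f (θ h x)            ∎)
    where open ≋-Reasoning

  θ-∘ : ∀ g h x → θ g (θ h x) ≈ θ (g · h) x
  θ-∘ g@(u , eu) h@(v , _) x = f-injective (begin
    f (θ g (θ h x))                  ≈⟨ θ-spec g (θ h x) ⟩
    conjugate u (f (θ h x))          ≈⟨ ≋-conjugate u eu (θ-spec h x) ⟩
    conjugate u (conjugate v (f x))  ≡⟨ conjugate-∘ u v (f x) ⟩
    conjugate (u ++ v) (f x)         ≈⟨ θ-spec (g · h) x ⟨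
    f (θ (g · h) x)                  ∎)
    where open ≋-Reasoning

  θ-trivial : ∀ h → H (proj₁ h) → ∀ x → θ h x ≈ x
  θ-trivial h@(w , _) w∈H x = f-injective (begin
    f (θ h x)            ≈⟨ θ-spec h x ⟩
    conjugate w (f x)    ≈⟨ conjugate-absorb w∈H (f-even x) ⟩
    f x                  ∎)
    where open ≋-Reasoning

  θ-homo : ∀ g x y → θ g (x ∙ y) ≈ θ g x ∙ θ g y
  θ-homo g@(w , ew) x y = f-injective (begin
    f (θ g (x ∙ y))                          ≈⟨ θ-spec g (x ∙ y) ⟩
    conjugate w (f (x ∙ y))                  ≈⟨ ≋-conjugate w ew (f-homo x y) ⟩
    conjugate w (f x ++ f y)                 ≈⟨ ≈Δ⇒≋ (conjugate-++ w (f x) (f y)) ⟩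
    conjugate w (f x) ++ conjugate w (f y)   ≈⟨ ≋-congˡ (conjugate w (f x)) (θ-spec g y) ⟨
    conjugate w (f x) ++ f (θ g y)           ≈⟨ ≋-congʳ (f (θ g y)) (f-even (θ g y)) (θ-spec g x) ⟨
    f (θ g x) ++ f (θ g y)                   ≈⟨ f-homo (θ g x) (θ g y) ⟨
    f (θ g x ∙ θ g y)                        ∎)
    where open ≋-Reasoning

  θ-inverseʳ : ∀ g x → θ g (θ (g ⁻¹⁺) x) ≈ x
  θ-inverseʳ g@(w , _) x =
    trans (θ-∘ g (g ⁻¹⁺) x) (θ-trivial (g · g ⁻¹⁺) (resp (Δ.sym (reverse-inverseʳ w)) unit) x)

  θ-inverseˡ : ∀ g x → θ (g ⁻¹⁺) (θ g x) ≈ x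
  θ-inverseˡ g@(w , _) x =
    trans (θ-∘ (g ⁻¹⁺) g x) (θ-trivial (g ⁻¹⁺ · g) (resp (Δ.sym (reverse-inverseˡ w)) unit) x)

  automorphism : Δ⁺ → Aut S
  automorphism g = record
    { to        = θ g
    ; from      = θ (g ⁻¹⁺)
    ; to-cong   = θ-cong g
    ; from-cong = θ-cong (g ⁻¹⁺)
    ; to-hom    = θ-homo g
    ; to-from   = θ-inverseʳ g
    ; from-to   = θ-inverseˡ g
    }

  θ-f : ∀ s x → θ (f s , f-even s) x ≈ conj S s x
  θ-f s x = f-injective (begin
    f (θ (f s , f-even s) x)           ≈⟨ θ-spec (f s , f-even s) x ⟩
    conjugate (f s) (f x)              ≡⟨ ++-assoc (f s) (f x) (reverse (f s)) ⟨
    (f s ++ f x) ++ reverse (f s)      ≈⟨ ≋-congˡ (f s ++ f x) (f-inverse s) ⟨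
    (f s ++ f x) ++ f (s ⁻¹)           ≈⟨ ≋-congʳ (f (s ⁻¹)) (f-even (s ⁻¹)) (f-homo s x) ⟨
    f (s ∙ x) ++ f (s ⁻¹)              ≈⟨ f-homo (s ∙ x) (s ⁻¹) ⟨
    f (s ∙ x ∙ s ⁻¹)                   ∎)
    where open ≋-Reasoning

module Tbar {c ℓ t : Level} (S : Group c ℓ) {T : Group.Carrier S → Set t} (T-subgroup : IsSubgroup S T) where
  open Group S
  open IsSubgroup T-subgroup using (unit; mul)
  open SetoidReasoning setoid

  conj-cong : ∀ τ {x y} → x ≈ y → conj S τ x ≈ conj S τ y
  conj-cong τ x≈y = ∙-congʳ (∙-congˡ x≈y)

  conj-∘ : ∀ τ σ x → conj S τ (conj S σ x) ≈ conj S (τ ∙ σ) x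
  conj-∘ τ σ x = begin
    τ ∙ (σ ∙ x ∙ σ ⁻¹) ∙ τ ⁻¹     ≈⟨ ∙-congʳ (assoc τ (σ ∙ x) (σ ⁻¹)) ⟨
    τ ∙ (σ ∙ x) ∙ σ ⁻¹ ∙ τ ⁻¹     ≈⟨ ∙-congʳ (∙-congʳ (assoc τ σ x)) ⟨
    τ ∙ σ ∙ x ∙ σ ⁻¹ ∙ τ ⁻¹       ≈⟨ assoc (τ ∙ σ ∙ x) (σ ⁻¹) (τ ⁻¹) ⟩
    τ ∙ σ ∙ x ∙ (σ ⁻¹ ∙ τ ⁻¹)     ≈⟨ ∙-congˡ (GroupProperties.⁻¹-anti-homo-∙ S τ σ) ⟨
    τ ∙ σ ∙ x ∙ (τ ∙ σ) ⁻¹        ∎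

  conj-ε : ∀ x → conj S ε x ≈ x
  conj-ε x = begin
    ε ∙ x ∙ ε ⁻¹  ≈⟨ ∙-cong (identityˡ x) (GroupProperties.ε⁻¹≈ε S) ⟩
    x ∙ ε         ≈⟨ identityʳ x ⟩
    x             ∎

  InTbar-resp : ∀ {φ ψ : Carrier → Carrier} → InTbar S T φ → (∀ x → ψ x ≈ φ x) → InTbar S T ψ
  InTbar-resp (τ , τ∈T , φ≈conjτ) ψ≈φ = τ , τ∈T , λ x → trans (ψ≈φ x) (φ≈conjτ x)

  InTbar-id : ∀ {φ : Carrier → Carrier} → (∀ x → φ x ≈ x) → InTbar S T φ
  InTbar-id φ≈id = ε , unit , λ x → trans (φ≈id x) (sym (conj-ε x))

  InTbar-∘ : ∀ {φ ψ : Carrier → Carrier} → InTbar S T φ → InTbar S T ψ → InTbar S T (φ ∘ ψ)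
  InTbar-∘ {φ} {ψ} (τ , τ∈T , φ≈conjτ) (σ , σ∈T , ψ≈conjσ) = τ ∙ σ , mul τ∈T σ∈T , λ x → begin
    φ (ψ x)                ≈⟨ φ≈conjτ (ψ x) ⟩
    conj S τ (ψ x)         ≈⟨ conj-cong τ (ψ≈conjσ x) ⟩
    conj S τ (conj S σ x)  ≈⟨ conj-∘ τ σ x ⟩
    conj S (τ ∙ σ) x       ∎

module _ {H : Word → Set} (hs : HypermapSubgroup H) {c ℓ t : Level} {S : Group c ℓ}
         (iso : ChiralityIso H S) {T : Group.Carrier S → Set t}
         (T-subgroup : IsSubgroup S T) (abelian : AutModTbarAbelian S T) where
  open HypermapSubgroup hs using (resp; unit; inΔ⁺)
  open ChiralityIso iso using (f; f-in)
  open ConjugationAction hs iso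
  open Tbar S T-subgroup
  open Group S using (setoid)
  open SetoidReasoning setoid

  commutator-in-Tbar : ∀ g h → InTbar S T (θ (commutator g h))
  commutator-in-Tbar g h = InTbar-resp (abelian (automorphism g) (automorphism h)) λ x → begin
    θ (commutator g h) x                          ≈⟨ θ-∘ g (h · (g ⁻¹⁺ · h ⁻¹⁺)) x ⟨
    θ g (θ (h · (g ⁻¹⁺ · h ⁻¹⁺)) x)               ≈⟨ θ-cong g (θ-∘ h (g ⁻¹⁺ · h ⁻¹⁺) x) ⟨
    θ g (θ h (θ (g ⁻¹⁺ · h ⁻¹⁺) x))               ≈⟨ θ-cong g (θ-cong h (θ-∘ (g ⁻¹⁺) (h ⁻¹⁺) x)) ⟨
    θ g (θ h (θ (g ⁻¹⁺) (θ (h ⁻¹⁺) x)))           ∎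

  twisted-square-in-Tbar : ∀ g → InTbar S T (θ (g · g ʳ))
  twisted-square-in-Tbar g@([] , _) =
    InTbar-id (θ-trivial (g · g ʳ) (resp (Δ.sym (cancel-pair [] r₂ [])) unit))
  twisted-square-in-Tbar (_ ∷ [] , ())
  twisted-square-in-Tbar g@(a ∷ b ∷ w , ew) =
    InTbar-resp (InTbar-∘ (commutator-in-Tbar u v) (InTbar-∘ (commutator-in-Tbar q w⁺) (twisted-square-in-Tbar (w , ew))))
      λ x → begin
        θ (g · g ʳ) x                                               ≈⟨ θ-resp (g · g ʳ) _ (twisted-square-∷ a b w) x ⟩
        θ (commutator u v · (commutator q w⁺ · (w⁺ · w⁺ ʳ))) x       ≈⟨ θ-∘ (commutator u v) _ x ⟨
        θ (commutator u v) (θ (commutator q w⁺ · (w⁺ · w⁺ ʳ)) x)     ≈⟨ θ-cong (commutator u v) (θ-∘ (commutator q w⁺) _ x) ⟨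
        θ (commutator u v) (θ (commutator q w⁺) (θ (w⁺ · w⁺ ʳ) x))   ∎
    where
    u v q w⁺ : Δ⁺
    u = a ∷ r₂ ∷ [] , refl
    v = r₂ ∷ b ∷ [] , refl
    q = r₂ ∷ b ∷ a ∷ r₂ ∷ [] , refl
    w⁺ = w , ew

  inner-in-Tbar : ∀ s → InTbar S T (conj S s)
  inner-in-Tbar s with f-in s
  ... | h , k , h∈H , k∈Hʳ , fs≈hk = InTbar-resp (twisted-square-in-Tbar k⁺) λ x → begin
    conj S s x               ≈⟨ θ-f s x ⟨
    θ (f s , f-even s) x     ≈⟨ θ-resp (f s , f-even s) (h⁺ · k⁺) fs≈hk x ⟩
    θ (h⁺ · k⁺) x            ≈⟨ θ-∘ h⁺ k⁺ x ⟨
    θ h⁺ (θ k⁺ x)            ≈⟨ θ-trivial h⁺ h∈H (θ k⁺ x) ⟩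
    θ k⁺ x                   ≈⟨ θ-cong k⁺ (θ-trivial (k⁺ ʳ) k∈Hʳ x) ⟨
    θ k⁺ (θ (k⁺ ʳ) x)        ≈⟨ θ-∘ k⁺ (k⁺ ʳ) x ⟩
    θ (k⁺ · k⁺ ʳ) x          ∎
    where
    h⁺ k⁺ : Δ⁺
    h⁺ = h , inΔ⁺ h∈H
    k⁺ = k , even-mirror⁻¹ k (inΔ⁺ k∈Hʳ)

theorem21 : {c ℓ t : Level} (S : Group c ℓ) (T : Group.Carrier S → Set t) →
    IsCharacteristic S T → TbarProper S T → AutModTbarAbelian S T →
    ¬ IsChiralityGroup S
theorem21 S T characteristic proper abelian (H , hs , iso) =
  proper (inner-in-Tbar hs iso (IsCharacteristic.subgroup characteristic) abelian)
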